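{- Consider representations of a positive integer as $h-k$ with $h,k$ harmonic numbers. Then: (i) The only such representations of $3$ are $4-1$, $6-3$, $9-6$, $12-9$, and $27-24$. (ii) The only such representations of $5$ are $6-1$, $9-4$, $8-3$, and $32-27$. (iii) The only such representations of $17$ are $18-1$ and $81-64$. (iv) For every integer $k\ge 3$ such that $F_k=2^{2^k}+1$ is prime, $F_k$ is an $ndh$-number.
   Context: A harmonic number is a positive integer of the form $2^a3^b$ with $a,b\ge 0$ integers (so $1$ is harmonic). A positive integer is an $ndh$-number if it cannot be written as a difference $h-k$ of two harmonic numbers $h,k$. A Fermat prime is a prime of the form $F_k=2^{2^k}+1$, $k\ge 0$. -}

module Defs where

open import Data.Nat using (ℕ; _+_; _*_; _^_; _<_)
open import Data.Product using (Σ; ∃; _×_; _,_)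
open import Relation.Nullary using (¬_)
open import Relation.Binary.PropositionalEquality using (_≡_)

Harmonic : ℕ → Set
Harmonic n = Σ ℕ λ a → Σ ℕ λ b → n ≡ 2 ^ a * 3 ^ b

-- (h , k) is a representation of n as a difference h - k of harmonic numbers
-- (n positive, so h - k = n in ℤ is the same as h = k + n in ℕ).
IsRep : ℕ → ℕ → ℕ → Set
IsRep n h k = Harmonic h × Harmonic k × h ≡ k + n

NDH : ℕ → Set
NDH n = 0 < n × ¬ (Σ ℕ λ h → Σ ℕ λ k → IsRep n h k)

Fermat : ℕ → ℕ
Fermat k = 2 ^ (2 ^ k) + 1

-- Let h = k + n with h, k harmonic and n odd.  Since n is odd, h and k are
-- not both even, and a case split on the exponents (`shape`) shows that
-- either k = 1, or {h, k} = {3^b, 2^c}, or h, k and n are three times a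
-- representation of n / 3.  The middle case is an exponential equation
-- g₁^x = g₂^y + n, solved by a certificate checked by evaluation: the powers
-- of 2 and 3 are eventually periodic modulo a well-chosen M (`Cycle`), so a
-- finite table of residues bounds one exponent of every solution
-- (`modular-bound`), which bounds the other, and a finite search lists all
-- solutions (`solutions`).  This classifies the representations of 1, 3, 5
-- and 17 (those of 3 reduce to those of 1).  For a Fermat number F_k with
-- k ≥ 3 one has F_k ≡ 257 (mod 8160); since F_k is odd and prime to 3, the
-- same residue tables modulo 8160 exclude every case, so F_k is an
-- ndh-number.
module Submission where

open import Defs

open import Data.Nat using (ℕ; zero; suc; _+_; _*_; _^_; _∸_; _≤_; _<_; z≤n; s≤s; s≤s⁻¹; NonZero; _≡ᵇ_; _<ᵇ_; _%_; _/_)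
open import Data.Nat.Properties
open import Data.Nat.Primality using (Prime)
open import Data.Nat.Divisibility using (_∣_; divides; m∣m*n; ∣m⇒∣m*n; ∣m+n∣m⇒∣n; n∣m⇒m%n≡0)
open import Data.Nat.DivMod using (%-distribˡ-*; %-distribˡ-+; m%n<n; m≡m%n+[m/n]*n; m∣n⇒o%n%m≡o%m)
open import Data.Nat.Tactic.RingSolver using (solve-∀)
open import Data.Bool using (Bool; true; false; _∧_; _∨_; not; T)
open import Data.Bool.Properties using (T-∧; T-∨)
open import Data.Product using (Σ; _×_; _,_; proj₁; proj₂; uncurry)
open import Data.Product.Properties using (≡-dec)
open import Data.Unit using (tt)
open import Data.Empty using (⊥; ⊥-elim)
open import Data.Sum using (_⊎_; inj₁; inj₂)
open import Data.List using (List; _∷_; []; map)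
open import Data.List.Relation.Unary.Any using (here; there)
open import Data.List.Relation.Unary.All using (All; lookup; _∷_; [])
open import Data.List.Membership.Propositional using (_∈_)
open import Data.List.Membership.Propositional.Properties using (∈-map⁺)
open import Data.List.Membership.DecPropositional (≡-dec _≟_ _≟_) using (_∈?_)
open import Function using (case_of_)
open import Function.Bundles using (_⇔_; mk⇔; Equivalence)
open import Relation.Nullary using (yes; no; ¬_; contradiction)
open import Relation.Nullary.Decidable using (⌊_⌋; toWitness)
open import Relation.Binary.PropositionalEquality

all< : ℕ → (ℕ → Bool) → Bool
all< zero    p = true
all< (suc n) p = p n ∧ all< n p

all<-sound : ∀ {n p} → T (all< n p) → ∀ {i} → i < n → T (p i)
all<-sound {suc n} holds {i} i<1+n with m≤n⇒m<n∨m≡n (s≤s⁻¹ i<1+n)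
... | inj₁ i<n  = all<-sound {n} (proj₂ (Equivalence.to T-∧ holds)) i<n
... | inj₂ refl = proj₁ (Equivalence.to T-∧ holds)

infixr 1 _⇒ᵇ_
_⇒ᵇ_ : Bool → Bool → Bool
true  ⇒ᵇ c = c
false ⇒ᵇ c = true

⇒ᵇ-mp : ∀ {b c} → T (b ⇒ᵇ c) → T b → T c
⇒ᵇ-mp {true} c _ = c

T-not : ∀ {b} → T (not b) → ¬ T b
T-not {false} _ ()

%-cong-*ˡ : ∀ c {x y M} .{{_ : NonZero M}} → x % M ≡ y % M → (c * x) % M ≡ (c * y) % M
%-cong-*ˡ c {x} {y} {M} x≡y = begin
  (c * x) % M             ≡⟨ %-distribˡ-* c x M ⟩
  (c % M * (x % M)) % M   ≡⟨ cong (λ r → (c % M * r) % M) x≡y ⟩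
  (c % M * (y % M)) % M   ≡⟨ %-distribˡ-* c y M ⟨
  (c * y) % M             ∎
  where open ≡-Reasoning

regroup : ∀ e q p t → e + (p + q * p) + t ≡ e + q * p + (t + p)
regroup = solve-∀

record Cycle (g M : ℕ) .{{_ : NonZero M}} : Set where
  constructor cycle
  field
    start period   : ℕ
    {{period≢0}}   : NonZero period
    closes         : g ^ (start + period) % M ≡ g ^ start % M

  -- the number of exponents that represent all residues of powers of g
  length : ℕ
  length = start + period

module _ {g M : ℕ} .{{_ : NonZero M}} (C : Cycle g M) where
  open Cycle C

  cycle-step : ∀ e → g ^ (e + length) % M ≡ g ^ (e + start) % M
  cycle-step e = begin
    g ^ (e + length) % M         ≡⟨ cong (_% M) (^-distribˡ-+-* g e length) ⟩
    (g ^ e * g ^ length) % M     ≡⟨ %-cong-*ˡ (g ^ e) closes ⟩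
    (g ^ e * g ^ start) % M      ≡⟨ cong (_% M) (^-distribˡ-+-* g e start) ⟨
    g ^ (e + start) % M          ∎
    where open ≡-Reasoning

  cycle-steps : ∀ e q → g ^ (e + q * period + start) % M ≡ g ^ (e + start) % M
  cycle-steps e zero    = cong (λ x → g ^ (x + start) % M) (+-identityʳ e)
  cycle-steps e (suc q) = begin
    g ^ (e + (period + q * period) + start) % M ≡⟨ cong (λ x → g ^ x % M) (regroup e q period start) ⟩
    g ^ (e + q * period + length) % M           ≡⟨ cycle-step (e + q * period) ⟩
    g ^ (e + q * period + start) % M            ≡⟨ cycle-steps e q ⟩
    g ^ (e + start) % M                         ∎
    where open ≡-Reasoning

  reduce : ∀ a → Σ ℕ λ a' → a' < length × g ^ a % M ≡ g ^ a' % M × (a' ≡ a ⊎ start ≤ a')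
  reduce a with a <? start
  ... | yes a<start = a , ≤-trans a<start (m≤m+n start period) , refl , inj₁ refl
  ... | no  a≮start = e % period + start , in-range , same-residue , inj₂ (m≤n+m start _)
    where
      e : ℕ
      e = a ∸ start
      in-range : e % period + start < length
      in-range = subst (e % period + start <_) (+-comm period start) (+-monoˡ-< start (m%n<n e period))
      split : a ≡ e % period + e / period * period + start
      split = begin
        a                                      ≡⟨ m∸n+n≡m (≮⇒≥ a≮start) ⟨
        e + start                              ≡⟨ cong (_+ start) (m≡m%n+[m/n]*n e period) ⟩
        e % period + e / period * period + start ∎
        where open ≡-Reasoning
      same-residue : g ^ a % M ≡ g ^ (e % period + start) % M
      same-residue = trans (cong (λ x → g ^ x % M) split) (cycle-steps (e % period) (e / period))

n<g^n : ∀ {g} → 1 < g → ∀ n → n < g ^ n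
n<g^n 1<g zero    = s≤s z≤n
n<g^n {g} 1<g (suc n) = begin-strict
  suc n          ≤⟨ ih ⟩
  g ^ n          <⟨ m<m+n (g ^ n) (≤-trans (s≤s z≤n) ih) ⟩
  g ^ n + g ^ n  ≡⟨ cong (g ^ n +_) (+-identityʳ (g ^ n)) ⟨
  2 * g ^ n      ≤⟨ *-monoˡ-≤ (g ^ n) 1<g ⟩
  g * g ^ n      ∎
  where
    open ≤-Reasoning
    ih : n < g ^ n
    ih = n<g^n 1<g n

representative-below : ∀ {a a' start X} → (a' ≡ a ⊎ start ≤ a') → a' < X → X ≤ start → a < X
representative-below (inj₁ refl)    a'<X _       = a'<X
representative-below (inj₂ start≤a') a'<X X≤start = contradiction (≤-trans X≤start start≤a') (<⇒≱ a'<X)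

module _ {g₁ g₂ M : ℕ} .{{_ : NonZero M}} (C₁ : Cycle g₁ M) (C₂ : Cycle g₂ M) where
  open Cycle

  modular-certificate : (r X Y : ℕ) → Bool
  modular-certificate r X Y =
    all< (length C₁) λ x → all< (length C₂) λ y →
      (g₁ ^ x % M ≡ᵇ (g₂ ^ y % M + r) % M) ⇒ᵇ ((x <ᵇ X) ∨ (y <ᵇ Y))

  -- A certificate bounds one exponent of every solution, provided the bounds
  -- lie in the preperiods (where representatives are exact).
  modular-bound : ∀ {r X Y} → X ≤ start C₁ → Y ≤ start C₂ → T (modular-certificate r X Y)
    → ∀ x y {n} → n % M ≡ r → g₁ ^ x ≡ g₂ ^ y + n → x < X ⊎ y < Y
  modular-bound {r} {X} {Y} X≤t₁ Y≤t₂ cert x y {n} n≡r eq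
    with reduce C₁ x | reduce C₂ y
  ... | x' , x'<ℓ , x≡x' , exact-x | y' , y'<ℓ , y≡y' , exact-y
    with Equivalence.to T-∨ (⇒ᵇ-mp (all<-sound (all<-sound cert x'<ℓ) y'<ℓ) (≡⇒≡ᵇ _ _ congruent))
    where
      open ≡-Reasoning
      congruent : g₁ ^ x' % M ≡ (g₂ ^ y' % M + r) % M
      congruent = begin
        g₁ ^ x' % M                ≡⟨ x≡x' ⟨
        g₁ ^ x % M                 ≡⟨ cong (_% M) eq ⟩
        (g₂ ^ y + n) % M           ≡⟨ %-distribˡ-+ (g₂ ^ y) n M ⟩
        (g₂ ^ y % M + n % M) % M   ≡⟨ cong₂ (λ u v → (u + v) % M) y≡y' n≡r ⟩
        (g₂ ^ y' % M + r) % M      ∎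
  ... | inj₁ x'<X = inj₁ (representative-below exact-x (<ᵇ⇒< x' X x'<X) X≤t₁)
  ... | inj₂ y'<Y = inj₂ (representative-below exact-y (<ᵇ⇒< y' Y y'<Y) Y≤t₂)

  product-certificate : (r : ℕ) → Bool
  product-certificate r =
    all< (length C₁) λ a → all< (length C₂) λ b → not (((g₁ ^ a % M) * (g₂ ^ b % M)) % M ≡ᵇ r)

  product-residue-excluded : ∀ {r} → T (product-certificate r) → ∀ a b → (g₁ ^ a * g₂ ^ b) % M ≢ r
  product-residue-excluded {r} cert a b ≡r with reduce C₁ a | reduce C₂ b
  ... | a' , a'<ℓ , a≡a' , _ | b' , b'<ℓ , b≡b' , _ =
    T-not (all<-sound (all<-sound cert a'<ℓ) b'<ℓ) (≡⇒≡ᵇ _ _ congruent)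
    where
      open ≡-Reasoning
      congruent : ((g₁ ^ a' % M) * (g₂ ^ b' % M)) % M ≡ r
      congruent = begin
        ((g₁ ^ a' % M) * (g₂ ^ b' % M)) % M ≡⟨ cong₂ (λ u v → (u * v) % M) a≡a' b≡b' ⟨
        ((g₁ ^ a % M) * (g₂ ^ b % M)) % M   ≡⟨ %-distribˡ-* (g₁ ^ a) (g₂ ^ b) M ⟨
        (g₁ ^ a * g₂ ^ b) % M               ≡⟨ ≡r ⟩
        r                                   ∎

search-certificate : (g₁ g₂ n X Y : ℕ) → List (ℕ × ℕ) → Bool
search-certificate g₁ g₂ n X Y L =
  all< X λ x → all< Y λ y → (g₁ ^ x ≡ᵇ g₂ ^ y + n) ⇒ᵇ ⌊ (x , y) ∈? L ⌋

search-sound : ∀ {g₁ g₂ n X Y L} → T (search-certificate g₁ g₂ n X Y L)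
  → ∀ {x y} → x < X → y < Y → g₁ ^ x ≡ g₂ ^ y + n → (x , y) ∈ L
search-sound cert x<X y<Y eq = toWitness (⇒ᵇ-mp (all<-sound (all<-sound cert x<X) y<Y) (≡⇒≡ᵇ _ _ eq))

bound-y : ∀ {g₁ g₂ n x y X} → 1 < g₁ → 1 < g₂ → x < X → g₁ ^ x ≡ g₂ ^ y + n → y < g₁ ^ X
bound-y {g₁} {g₂} {n} {x} {y} {X} 1<g₁ 1<g₂ x<X eq = begin-strict
  y              <⟨ n<g^n 1<g₂ y ⟩
  g₂ ^ y         ≤⟨ m≤m+n (g₂ ^ y) n ⟩
  g₂ ^ y + n     ≡⟨ eq ⟨
  g₁ ^ x         <⟨ ^-monoʳ-< g₁ 1<g₁ x<X ⟩
  g₁ ^ X         ∎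
  where open ≤-Reasoning

bound-x : ∀ {g₁ g₂ n x y Y} → 1 < g₁ → 1 < g₂ → y < Y → g₁ ^ x ≡ g₂ ^ y + n → x < g₂ ^ Y + n
bound-x {g₁} {g₂} {n} {x} {y} {Y} 1<g₁ 1<g₂ y<Y eq = begin-strict
  x              <⟨ n<g^n 1<g₁ x ⟩
  g₁ ^ x         ≡⟨ eq ⟩
  g₂ ^ y + n     <⟨ +-monoˡ-< n (^-monoʳ-< g₂ 1<g₂ y<Y) ⟩
  g₂ ^ Y + n     ∎
  where open ≤-Reasoning

solutions : (g₁ g₂ n M : ℕ) .{{_ : NonZero M}} (C₁ : Cycle g₁ M) (C₂ : Cycle g₂ M)
  → 1 < g₁ → 1 < g₂ → ∀ {X Y} → X ≤ Cycle.start C₁ → Y ≤ Cycle.start C₂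
  → (L : List (ℕ × ℕ))
  → T (modular-certificate C₁ C₂ (n % M) X Y)
  → T (search-certificate g₁ g₂ n X (g₁ ^ X) L)
  → T (search-certificate g₁ g₂ n (g₂ ^ Y + n) Y L)
  → ∀ x y → g₁ ^ x ≡ g₂ ^ y + n → (x , y) ∈ L
solutions g₁ g₂ n M C₁ C₂ 1<g₁ 1<g₂ X≤t₁ Y≤t₂ L modular small-x small-y x y eq
  with modular-bound C₁ C₂ X≤t₁ Y≤t₂ modular x y refl eq
... | inj₁ x<X = search-sound small-x x<X (bound-y 1<g₁ 1<g₂ x<X eq) eq
... | inj₂ y<Y = search-sound small-y (bound-x 1<g₁ 1<g₂ y<Y eq) y<Y eq

1<2 : 1 < 2
1<2 = s≤s (s≤s z≤n)

1<3 : 1 < 3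
1<3 = s≤s (s≤s z≤n)

common-divisor : ∀ {d h k n} → d ∣ h → d ∣ k → h ≡ k + n → d ∣ n
common-divisor {d} d∣h d∣k h≡k+n = ∣m+n∣m⇒∣n (subst (d ∣_) h≡k+n d∣h) d∣k

odd⇒positive : ∀ {n} → ¬ 2 ∣ n → 0 < n
odd⇒positive {zero}  odd = ⊥-elim (odd (divides 0 refl))
odd⇒positive {suc n} _   = s≤s z≤n

harmonic-positive : ∀ a b → 0 < 2 ^ a * 3 ^ b
harmonic-positive a b = *-mono-≤ (m^n>0 2 a) (m^n>0 3 b)

pull-3 : ∀ x y → x * (3 * y) ≡ 3 * (x * y)
pull-3 = solve-∀

divide-by-3 : ∀ {n h' k'} → Harmonic h' → Harmonic k' → 3 * h' ≡ 3 * k' + n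
  → Σ ℕ λ m → n ≡ 3 * m × IsRep m h' k'
divide-by-3 {n} {h'} {k'} H' K' eq with common-divisor (m∣m*n h') (m∣m*n k') eq
... | divides m n≡m*3 = m , trans n≡m*3 (*-comm m 3) , H' , K' , *-cancelˡ-≡ h' (k' + m) 3 (begin
  3 * h'            ≡⟨ eq ⟩
  3 * k' + n        ≡⟨ cong (3 * k' +_) (trans n≡m*3 (*-comm m 3)) ⟩
  3 * k' + 3 * m    ≡⟨ *-distribˡ-+ 3 k' m ⟨
  3 * (k' + m)      ∎)
  where open ≡-Reasoning

data Shape (n h k : ℕ) : Set where
  unit      : k ≡ 1 → h ≡ 1 + n → Shape n h k
  pow3-pow2 : ∀ b c → h ≡ 3 ^ b → k ≡ 2 ^ c → 3 ^ b ≡ 2 ^ c + n → Shape n h k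
  pow2-pow3 : ∀ a d → h ≡ 2 ^ a → k ≡ 3 ^ d → 2 ^ a ≡ 3 ^ d + n → Shape n h k
  triple    : ∀ m h' k' → n ≡ 3 * m → h ≡ 3 * h' → k ≡ 3 * k' → IsRep m h' k' → Shape n h k

shape-triple : ∀ {n} a b c d → 2 ^ a * 3 ^ suc b ≡ 2 ^ c * 3 ^ suc d + n
  → Shape n (2 ^ a * 3 ^ suc b) (2 ^ c * 3 ^ suc d)
shape-triple {n} a b c d eq =
  let m , n≡3m , rep = divide-by-3 (a , b , refl) (c , d , refl) (subst₂ (λ u v → u ≡ v + n) h≡3h' k≡3k' eq)
  in triple m (2 ^ a * 3 ^ b) (2 ^ c * 3 ^ d) n≡3m h≡3h' k≡3k' rep
  where
    h≡3h' : 2 ^ a * 3 ^ suc b ≡ 3 * (2 ^ a * 3 ^ b)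
    h≡3h' = pull-3 (2 ^ a) (3 ^ b)
    k≡3k' : 2 ^ c * 3 ^ suc d ≡ 3 * (2 ^ c * 3 ^ d)
    k≡3k' = pull-3 (2 ^ c) (3 ^ d)

-- The shape lemma in terms of exponents: both even is excluded by parity,
-- h = 1 by size; k = 1, a pure power of 3 or of 2, or a common factor 3 remain.
shape-exponents : ∀ {n} → ¬ 2 ∣ n → ∀ a b c d → 2 ^ a * 3 ^ b ≡ 2 ^ c * 3 ^ d + n
  → Shape n (2 ^ a * 3 ^ b) (2 ^ c * 3 ^ d)
shape-exponents odd a b zero zero eq = unit refl eq
shape-exponents odd (suc a) b (suc c) d eq = ⊥-elim (odd (common-divisor (even a b) (even c d) eq))
  where
    even : ∀ a b → 2 ∣ 2 ^ suc a * 3 ^ b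
    even a b = ∣m⇒∣m*n (3 ^ b) (m∣m*n (2 ^ a))
shape-exponents odd zero zero c (suc d) eq =
  ⊥-elim (<⇒≢ (+-mono-≤ (harmonic-positive c (suc d)) (odd⇒positive odd)) eq)
shape-exponents odd zero (suc b) c (suc d) eq = shape-triple zero b c d eq
shape-exponents {n} odd zero b c zero eq =
  pow3-pow2 b c (*-identityˡ _) (*-identityʳ _) (subst₂ (λ u v → u ≡ v + n) (*-identityˡ _) (*-identityʳ _) eq)
shape-exponents {n} odd (suc a) zero zero d eq =
  pow2-pow3 (suc a) d (*-identityʳ _) (*-identityˡ _) (subst₂ (λ u v → u ≡ v + n) (*-identityʳ _) (*-identityˡ _) eq)
shape-exponents odd (suc a) (suc b) zero (suc d) eq = shape-triple (suc a) b zero d eq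

shape : ∀ {n h k} → ¬ 2 ∣ n → IsRep n h k → Shape n h k
shape odd ((a , b , refl) , (c , d , refl) , eq) = shape-exponents odd a b c d eq

∤-by-residue : ∀ {d n} .{{_ : NonZero d}} → n % d ≢ 0 → ¬ d ∣ n
∤-by-residue {d} {n} n%d≢0 d∣n = n%d≢0 (n∣m⇒m%n≡0 n d d∣n)

no-triple : ∀ {n m} → ¬ 3 ∣ n → n ≡ 3 * m → ⊥
no-triple {n} {m} 3∤n n≡3m = 3∤n (divides m (trans n≡3m (*-comm 3 m)))

3^x≡2^y+1 : ∀ x y → 3 ^ x ≡ 2 ^ y + 1 → (x , y) ∈ (1 , 1) ∷ (2 , 3) ∷ []
3^x≡2^y+1 = solutions 3 2 1 80 (cycle 0 4 refl) (cycle 4 4 refl) 1<3 1<2 z≤n ≤-refl _ tt tt tt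

2^x≡3^y+1 : ∀ x y → 2 ^ x ≡ 3 ^ y + 1 → (x , y) ∈ (1 , 0) ∷ (2 , 1) ∷ []
2^x≡3^y+1 = solutions 2 3 1 8 (cycle 3 1 refl) (cycle 0 2 refl) 1<2 1<3 ≤-refl z≤n _ tt tt tt

3^x≡2^y+3 : ∀ x y → 3 ^ x ≡ 2 ^ y + 3 → (x , y) ∈ []
3^x≡2^y+3 = solutions 3 2 3 12 (cycle 1 2 refl) (cycle 2 2 refl) 1<3 1<2 z≤n z≤n _ tt tt tt

2^x≡3^y+3 : ∀ x y → 2 ^ x ≡ 3 ^ y + 3 → (x , y) ∈ (2 , 0) ∷ []
2^x≡3^y+3 = solutions 2 3 3 24 (cycle 3 2 refl) (cycle 1 2 refl) 1<2 1<3 ≤-refl z≤n _ tt tt tt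

3^x≡2^y+5 : ∀ x y → 3 ^ x ≡ 2 ^ y + 5 → (x , y) ∈ (2 , 2) ∷ []
3^x≡2^y+5 = solutions 3 2 5 8 (cycle 0 2 refl) (cycle 3 1 refl) 1<3 1<2 z≤n ≤-refl _ tt tt tt

2^x≡3^y+5 : ∀ x y → 2 ^ x ≡ 3 ^ y + 5 → (x , y) ∈ (3 , 1) ∷ (5 , 3) ∷ []
2^x≡3^y+5 = solutions 2 3 5 3264 (cycle 6 8 refl) (cycle 1 16 refl) 1<2 1<3 ≤-refl z≤n _ tt tt tt

3^x≡2^y+17 : ∀ x y → 3 ^ x ≡ 2 ^ y + 17 → (x , y) ∈ (4 , 6) ∷ []
3^x≡2^y+17 = solutions 3 2 17 32896 (cycle 0 256 refl) (cycle 7 16 refl) 1<3 1<2 z≤n ≤-refl _ tt tt tt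

2^x≡3^y+17 : ∀ x y → 2 ^ x ≡ 3 ^ y + 17 → (x , y) ∈ []
2^x≡3^y+17 = solutions 2 3 17 96 (cycle 5 2 refl) (cycle 1 8 refl) 1<2 1<3 ≤-refl z≤n _ tt tt tt

representations-of-1 : List (ℕ × ℕ)
representations-of-1 = (2 , 1) ∷ (3 , 2) ∷ (4 , 3) ∷ (9 , 8) ∷ []

reps-of-1 : ∀ {h k} → IsRep 1 h k → (h , k) ∈ representations-of-1
reps-of-1 rep with shape (∤-by-residue (λ ())) rep
... | unit refl refl = here refl
... | pow3-pow2 b c refl refl eq with 3^x≡2^y+1 b c eq
...   | here refl         = there (here refl)
...   | there (here refl) = there (there (there (here refl)))
reps-of-1 rep | pow2-pow3 a d refl refl eq with 2^x≡3^y+1 a d eq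
...   | here refl         = here refl
...   | there (here refl) = there (there (here refl))
reps-of-1 rep | triple m _ _ 1≡3m _ _ _ = ⊥-elim (no-triple {m = m} (∤-by-residue (λ ())) 1≡3m)

times-3 : ℕ × ℕ → ℕ × ℕ
times-3 (h , k) = 3 * h , 3 * k

representations-of-3 : List (ℕ × ℕ)
representations-of-3 = (4 , 1) ∷ map times-3 representations-of-1

reps-of-3 : ∀ {h k} → IsRep 3 h k → (h , k) ∈ representations-of-3
reps-of-3 rep with shape (∤-by-residue (λ ())) rep
... | unit refl refl = here refl
... | pow3-pow2 b c refl refl eq with 3^x≡2^y+3 b c eq
...   | ()
reps-of-3 rep | pow2-pow3 a d refl refl eq with 2^x≡3^y+3 a d eq
...   | here refl = here refl
reps-of-3 rep | triple m _ _ 3≡3m refl refl rep′ with *-cancelˡ-≡ 1 m 3 3≡3m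
...   | refl = there (∈-map⁺ times-3 (reps-of-1 rep′))

representations-of-5 : List (ℕ × ℕ)
representations-of-5 = (6 , 1) ∷ (9 , 4) ∷ (8 , 3) ∷ (32 , 27) ∷ []

reps-of-5 : ∀ {h k} → IsRep 5 h k → (h , k) ∈ representations-of-5
reps-of-5 rep with shape (∤-by-residue (λ ())) rep
... | unit refl refl = here refl
... | pow3-pow2 b c refl refl eq with 3^x≡2^y+5 b c eq
...   | here refl = there (here refl)
reps-of-5 rep | pow2-pow3 a d refl refl eq with 2^x≡3^y+5 a d eq
...   | here refl         = there (there (here refl))
...   | there (here refl) = there (there (there (here refl)))
reps-of-5 rep | triple m _ _ 5≡3m _ _ _ = ⊥-elim (no-triple {m = m} (∤-by-residue (λ ())) 5≡3m)

representations-of-17 : List (ℕ × ℕ)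
representations-of-17 = (18 , 1) ∷ (81 , 64) ∷ []

reps-of-17 : ∀ {h k} → IsRep 17 h k → (h , k) ∈ representations-of-17
reps-of-17 rep with shape (∤-by-residue (λ ())) rep
... | unit refl refl = here refl
... | pow3-pow2 b c refl refl eq with 3^x≡2^y+17 b c eq
...   | here refl = there (here refl)
reps-of-17 rep | pow2-pow3 a d refl refl eq with 2^x≡3^y+17 a d eq
...   | ()
reps-of-17 rep | triple m _ _ 17≡3m _ _ _ = ⊥-elim (no-triple {m = m} (∤-by-residue (λ ())) 17≡3m)

listed-3 : All (uncurry (IsRep 3)) representations-of-3
listed-3 = ((2 , 0 , refl) , (0 , 0 , refl) , refl) ∷ ((1 , 1 , refl) , (0 , 1 , refl) , refl)
  ∷ ((0 , 2 , refl) , (1 , 1 , refl) , refl) ∷ ((2 , 1 , refl) , (0 , 2 , refl) , refl)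
  ∷ ((0 , 3 , refl) , (3 , 1 , refl) , refl) ∷ []

listed-5 : All (uncurry (IsRep 5)) representations-of-5
listed-5 = ((1 , 1 , refl) , (0 , 0 , refl) , refl) ∷ ((0 , 2 , refl) , (2 , 0 , refl) , refl)
  ∷ ((3 , 0 , refl) , (0 , 1 , refl) , refl) ∷ ((5 , 0 , refl) , (0 , 3 , refl) , refl) ∷ []

listed-17 : All (uncurry (IsRep 17)) representations-of-17
listed-17 = ((1 , 2 , refl) , (0 , 0 , refl) , refl) ∷ ((0 , 4 , refl) , (6 , 0 , refl) , refl) ∷ []

square-idempotent : ∀ {x r M} .{{_ : NonZero M}} → (r * r) % M ≡ r → x % M ≡ r → (x * x) % M ≡ r
square-idempotent {x} {r} {M} r²≡r x≡r = begin
  (x * x) % M             ≡⟨ %-distribˡ-* x x M ⟩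
  (x % M * (x % M)) % M   ≡⟨ cong₂ (λ u v → (u * v) % M) x≡r x≡r ⟩
  (r * r) % M             ≡⟨ r²≡r ⟩
  r                       ∎
  where open ≡-Reasoning

pow-double : ∀ g e → g ^ (2 * e) ≡ g ^ e * g ^ e
pow-double g e = trans (cong (g ^_) (cong (e +_) (+-identityʳ e))) (^-distribˡ-+-* g e e)

-- 256 is idempotent modulo 8160 = 2^5·3·5·17 and 2^(2^3) = 256, so every
-- Fermat number F_k with k ≥ 3 is congruent to 257 modulo 8160.
2^2^k-mod-8160 : ∀ j → 2 ^ (2 ^ (3 + j)) % 8160 ≡ 256
2^2^k-mod-8160 zero    = refl
2^2^k-mod-8160 (suc j) =
  trans (cong (_% 8160) (pow-double 2 (2 ^ (3 + j)))) (square-idempotent {2 ^ (2 ^ (3 + j))} refl (2^2^k-mod-8160 j))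

fermat-mod-8160 : ∀ j → Fermat (3 + j) % 8160 ≡ 257
fermat-mod-8160 j =
  trans (%-distribˡ-+ (2 ^ (2 ^ (3 + j))) 1 8160) (cong (λ u → (u + 1) % 8160) (2^2^k-mod-8160 j))

fermat-mod : ∀ j d .{{_ : NonZero d}} → d ∣ 8160 → Fermat (3 + j) % d ≡ 257 % d
fermat-mod j d d∣8160 = trans (sym (m∣n⇒o%n%m≡o%m d 8160 _ d∣8160)) (cong (_% d) (fermat-mod-8160 j))

2∤fermat : ∀ j → ¬ 2 ∣ Fermat (3 + j)
2∤fermat j = ∤-by-residue (λ F%2≡0 → case trans (sym (fermat-mod j 2 (divides 4080 refl))) F%2≡0 of λ ())

3∤fermat : ∀ j → ¬ 3 ∣ Fermat (3 + j)
3∤fermat j = ∤-by-residue (λ F%3≡0 → case trans (sym (fermat-mod j 3 (divides 2720 refl))) F%3≡0 of λ ())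

2-mod-8160 : Cycle 2 8160
2-mod-8160 = cycle 5 8 refl

3-mod-8160 : Cycle 3 8160
3-mod-8160 = cycle 1 16 refl

-- No F_k with k ≥ 3 is a difference of harmonic numbers: modulo 8160 no
-- harmonic number is ≡ 258 = F_k + 1, and neither 3^b - 2^c nor 2^a - 3^d is ≡ 257.
fermat-not-rep : ∀ j {h k} → IsRep (Fermat (3 + j)) h k → ⊥
fermat-not-rep j rep@((a , b , h≡2^a3^b) , _ , _) with shape (2∤fermat j) rep
... | unit refl refl =
  product-residue-excluded 2-mod-8160 3-mod-8160 tt a b (trans (cong (_% 8160) (sym h≡2^a3^b)) F+1≡258)
  where
    F+1≡258 : (1 + Fermat (3 + j)) % 8160 ≡ 258
    F+1≡258 = trans (%-distribˡ-+ 1 (Fermat (3 + j)) 8160) (cong (λ u → (1 + u) % 8160) (fermat-mod-8160 j))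
... | pow3-pow2 b c refl refl eq
  with modular-bound 3-mod-8160 2-mod-8160 z≤n z≤n tt b c (fermat-mod-8160 j) eq
...   | inj₁ ()
...   | inj₂ ()
fermat-not-rep j rep | pow2-pow3 a d refl refl eq
  with modular-bound 2-mod-8160 3-mod-8160 z≤n z≤n tt a d (fermat-mod-8160 j) eq
...   | inj₁ ()
...   | inj₂ ()
fermat-not-rep j rep | triple m _ _ F≡3m _ _ _ = no-triple {m = m} (3∤fermat j) F≡3m

fermat-ndh : ∀ j → NDH (Fermat (3 + j))
fermat-ndh j = odd⇒positive (2∤fermat j) , λ (h , k , rep) → fermat-not-rep j rep

theorem2p6 : ((h k : ℕ) → IsRep 3 h k ⇔ ((h , k) ∈ (4 , 1) ∷ (6 , 3) ∷ (9 , 6) ∷ (12 , 9) ∷ (27 , 24) ∷ []))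
    × ((h k : ℕ) → IsRep 5 h k ⇔ ((h , k) ∈ (6 , 1) ∷ (9 , 4) ∷ (8 , 3) ∷ (32 , 27) ∷ []))
    × ((h k : ℕ) → IsRep 17 h k ⇔ ((h , k) ∈ (18 , 1) ∷ (81 , 64) ∷ []))
    × ((k : ℕ) → 3 ≤ k → Prime (Fermat k) → NDH (Fermat k))
theorem2p6 =
    (λ h k → mk⇔ reps-of-3 (lookup listed-3))
  , (λ h k → mk⇔ reps-of-5 (lookup listed-5))
  , (λ h k → mk⇔ reps-of-17 (lookup listed-17))
  , fermat
  where
    fermat : (k : ℕ) → 3 ≤ k → Prime (Fermat k) → NDH (Fermat k)
    fermat (suc (suc (suc j))) (s≤s (s≤s (s≤s _))) _ = fermat-ndh j
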